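{- Let $b$ and $t$ be nonnegative integers, let $(T,<)$ be an ordered tree and let $\mathcal I$ be an interval family of $(T,<)$ with $|\mathcal I|=2(b+2)^t$. Then $T$ contains a $b$-branching node or $\mathcal I$ contains a $t$-interval path.
   Context: For a rooted tree $T$, $L(T)$ is its set of leaves and $L(x)$ the set of leaves descending from a node $x$. An ordered tree $(T,<)$ is a rooted tree with a linear order $<$ on $L(T)$ such that each $L(x)$ is an interval (set of consecutive elements) of $<$. An interval family of $(T,<)$ is a set $\mathcal I$ of pairwise disjoint intervals of $(L(T),<)$. A node $x$ is $b$-branching (with respect to $\mathcal I$) if there is a subset $\mathcal I'\subseteq\mathcal I$ of $b$ intervals, each included in $L(x)$, such that no child $y$ of $x$ has $L(y)$ intersecting two intervals of $\mathcal I'$. An $\ell$-interval path is a sequence $I_1,\dots,I_\ell$ of intervals of $\mathcal I$ for which there exist nodes $x_1,\dots,x_\ell$ of $T$ with $I_j\cup\dots\cup I_\ell\subseteq L(x_j)$ for all $j\in\{1,\dots,\ell\}$ and $L(x_j)\cap I_{j-1}=\emptyset$ for all $j\in\{2,\dots,\ell\}$. -}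

module Defs where

open import Data.Nat using (ℕ; zero; suc; _+_; _*_; _^_; _≤_; _<_)
open import Data.Fin using (Fin; toℕ)
open import Data.List using (List; []; _∷_)
open import Data.List.Relation.Unary.Any using (here; there)
open import Data.List.Membership.Propositional using (_∈_)
open import Data.Product using (Σ; _×_; ∃-syntax)
open import Relation.Binary.PropositionalEquality using (_≡_; _≢_)
open import Relation.Nullary using (¬_)
open import Data.Empty using (⊥)

-- Ordered (finite, rooted) trees, represented as planar rose trees.
-- The linear order on the leaves is the left-to-right order; leaves are
-- identified with their positions 0, 1, ..., leafCount T - 1, and the order
-- on leaves is the usual order on ℕ.  Every L(x) is then an interval, and
-- every ordered tree (T,<) is (isomorphic to) one of these.

data Tree : Set where
  node : List Tree → Tree

mutual
  leafCount : Tree → ℕ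
  leafCount (node [])       = 1
  leafCount (node (t ∷ ts)) = leafCountF (t ∷ ts)

  leafCountF : List Tree → ℕ
  leafCountF []       = 0
  leafCountF (t ∷ ts) = leafCount t + leafCountF ts

before : ∀ {u ts} → u ∈ ts → ℕ
before (here _)          = 0
before (there {x = x} m) = leafCount x + before m

-- Nodes of a tree: paths from the root.
data Pos : Tree → Set where
  root : ∀ {t} → Pos t
  down : ∀ {u ts} → u ∈ ts → Pos u → Pos (node ts)

subtree : ∀ {t} → Pos t → Tree
subtree {t} root = t
subtree (down _ p) = subtree p

-- global index of the leftmost leaf below a node
offset : ∀ {t} → Pos t → ℕ
offset root       = 0
offset (down m p) = before m + offset p

-- Child y x : y is a child of x
data Child : ∀ {t} → Pos t → Pos t → Set where
  top    : ∀ {u ts} (m : u ∈ ts) → Child (down m root) root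
  deeper : ∀ {u ts} {m : u ∈ ts} {p q : Pos u} →
           Child p q → Child (down m p) (down m q)

InL : ∀ {t} → Pos t → ℕ → Set
InL x k = offset x ≤ k × k < offset x + leafCount (subtree x)

record Interval (T : Tree) : Set where
  constructor interval
  field
    lo hi  : ℕ
    lo≤hi  : lo ≤ hi
    hi<T   : hi < leafCount T
open Interval public

InI : ∀ {T} → Interval T → ℕ → Set
InI I k = lo I ≤ k × k ≤ hi I

Disjoint : ∀ {T} → Interval T → Interval T → Set
Disjoint I J = ∀ k → InI I k → InI J k → ⊥

record IntervalFamily (T : Tree) (n : ℕ) : Set where
  field
    fam      : Fin n → Interval T
    disjoint : ∀ i j → i ≢ j → Disjoint (fam i) (fam j)
open IntervalFamily public

SubL : ∀ {T} → Interval T → Pos T → Set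
SubL I x = ∀ k → InI I k → InL x k

Meets : ∀ {T} → Pos T → Interval T → Set
Meets y I = ∃[ k ] (InL y k × InI I k)

Branching : ∀ {T n} → IntervalFamily T n → ℕ → Pos T → Set
Branching {T} {n} 𝓘 b x =
  Σ (Fin b → Fin n) λ sel →
    (∀ i j → sel i ≡ sel j → i ≡ j) ×
    (∀ i → SubL (fam 𝓘 (sel i)) x) ×
    (∀ (y : Pos T) → Child y x → ∀ i j → i ≢ j →
       Meets y (fam 𝓘 (sel i)) → Meets y (fam 𝓘 (sel j)) → ⊥)

-- an ℓ-interval path: members I_1..I_ℓ (indices 0..ℓ-1 here) and nodes
-- x_1..x_ℓ with I_j ∪ ... ∪ I_ℓ ⊆ L(x_j) and L(x_j) ∩ I_{j-1} = ∅.
IntervalPath : ∀ {T n} → IntervalFamily T n → ℕ → Set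
IntervalPath {T} {n} 𝓘 ℓ =
  Σ (Fin ℓ → Fin n) λ I →
  Σ (Fin ℓ → Pos T) λ x →
    (∀ j k → toℕ j ≤ toℕ k → SubL (fam 𝓘 (I k)) (x j)) ×
    (∀ i j → suc (toℕ i) ≡ toℕ j → ¬ Meets (x j) (fam 𝓘 (I i)))

-- Induction on t, counting the members of the family lying inside L(x).  Let
-- L(x) contain at least (b+2)·M members, M = 2(b+2)^(t-1).  Take the members
-- I₁ and Iₘ inside L(x) that start leftmost and end rightmost, and the deepest
-- node w below x whose leaves meet both: every other member inside L(x) lies
-- inside L(w), and no child of w meets both I₁ and Iₘ.  If some child of w
-- contains M members, it misses I₁ or Iₘ; the induction hypothesis gives a
-- (t-1)-interval path below that child, and x with the missed member extends
-- it.  Otherwise every child of w contains fewer than M members; choosing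
-- greedily from left to right the member starting first after the child that
-- holds the right end of the previous choice discards at most M + 1 members
-- per step, and yields b members no child of w meets twice.

module Submission where

open import Defs
open import Data.Empty using (⊥; ⊥-elim)
open import Data.Fin using (Fin; zero; suc; toℕ; _≟_)
open import Data.Fin.Properties using (suc-injective; 0≢1+n)
open import Data.List using (List; []; _∷_; filter; allFin)
open import Data.List.Extrema.Nat using (argmin; argmax; argmin-all; argmax-all; f[argmin]≤f[xs]; f[xs]≤f[argmax])
open import Data.List.Membership.Propositional using (_∈_)
open import Data.List.Membership.Propositional.Properties using (∈-filter⁺; ∈-allFin)
open import Data.List.Relation.Unary.All using (lookup)
open import Data.List.Relation.Unary.All.Properties using (all-filter)
open import Data.List.Relation.Unary.Any using (here; there)
open import Data.Nat using (ℕ; zero; suc; _+_; _*_; _^_; _≤_; _<_; z≤n; s≤s; z<s; _<?_; _≤?_)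
import Data.Nat.Properties as ℕ
open import Data.Nat.Properties hiding (suc-injective; 0≢1+n; _≟_)
open import Data.Nat.Tactic.RingSolver using (solve-∀)
open import Data.Product using (Σ-syntax; _×_; _,_; ∃-syntax; proj₁; proj₂; uncurry)
open import Data.Sum as Sum using (_⊎_; inj₁; inj₂)
open import Function using (id; _∘_)
open import Level using (0ℓ)
open import Relation.Binary.PropositionalEquality
  using (_≡_; _≢_; refl; cong; cong₂; sym; trans; subst; module ≡-Reasoning)
open import Relation.Nullary using (¬_; Dec; yes; no; contradiction)
open import Relation.Nullary.Decidable using (map′; _×-dec_; decidable-stable)
open import Relation.Unary using (Pred; Decidable; _⊆_; _∪_; Empty; Satisfiable; Universal)
open import Relation.Unary.Properties using (_∪?_)

count : ∀ {n} {P : Pred (Fin n) 0ℓ} → Decidable P → ℕ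
count {zero}  P? = 0
count {suc n} P? with P? zero
... | yes _ = suc (count (P? ∘ suc))
... | no  _ = count (P? ∘ suc)

private
  variable
    n : ℕ
    P Q R : Pred (Fin n) 0ℓ

count-mono : (P? : Decidable P) (Q? : Decidable Q) → P ⊆ Q → count P? ≤ count Q?
count-mono {zero}  P? Q? P⊆Q = z≤n
count-mono {suc n} P? Q? P⊆Q with P? zero | Q? zero
... | yes _ | yes _ = s≤s (count-mono (P? ∘ suc) (Q? ∘ suc) P⊆Q)
... | yes p | no ¬q = contradiction (P⊆Q p) ¬q
... | no  _ | yes _ = m≤n⇒m≤1+n (count-mono (P? ∘ suc) (Q? ∘ suc) P⊆Q)
... | no  _ | no  _ = count-mono (P? ∘ suc) (Q? ∘ suc) P⊆Q

count-∪ : (Q? : Decidable Q) (R? : Decidable R) → count (Q? ∪? R?) ≤ count Q? + count R?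
count-∪ {zero}  Q? R? = z≤n
count-∪ {suc n} Q? R? with Q? zero | R? zero
... | yes _ | yes _ = s≤s (≤-trans (count-∪ (Q? ∘ suc) (R? ∘ suc)) (+-monoʳ-≤ _ (n≤1+n _)))
... | yes _ | no  _ = s≤s (count-∪ (Q? ∘ suc) (R? ∘ suc))
... | no  _ | yes _ = ≤-trans (s≤s (count-∪ (Q? ∘ suc) (R? ∘ suc))) (≤-reflexive (sym (+-suc _ _)))
... | no  _ | no  _ = count-∪ (Q? ∘ suc) (R? ∘ suc)

count-⊆∪ : (P? : Decidable P) (Q? : Decidable Q) (R? : Decidable R) →
           P ⊆ Q ∪ R → count P? ≤ count Q? + count R?
count-⊆∪ P? Q? R? P⊆Q∪R = ≤-trans (count-mono P? (Q? ∪? R?) P⊆Q∪R) (count-∪ Q? R?)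

count-Empty : (P? : Decidable P) → Empty P → count P? ≡ 0
count-Empty {zero}  P? ∅ = refl
count-Empty {suc n} P? ∅ with P? zero
... | yes p = contradiction p (∅ zero)
... | no  _ = count-Empty (P? ∘ suc) (∅ ∘ suc)

count-Universal : ∀ {n} {P : Pred (Fin n) 0ℓ} (P? : Decidable P) → Universal P → count P? ≡ n
count-Universal {zero}  P? all = refl
count-Universal {suc n} P? all with P? zero
... | yes _  = cong suc (count-Universal (P? ∘ suc) (all ∘ suc))
... | no  ¬p = contradiction (all zero) ¬p

count-unique : (P? : Decidable P) → (∀ {i j} → P i → P j → i ≡ j) → count P? ≤ 1
count-unique {zero}  P? unique = z≤n
count-unique {suc n} P? unique with P? zero
... | yes p = s≤s (≤-reflexive (count-Empty (P? ∘ suc) λ i q → 0≢1+n (unique p q)))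
... | no  _ = count-unique (P? ∘ suc) (λ p q → suc-injective (unique p q))

count-≟≤1 : ∀ {n} (i : Fin n) → count (_≟ i) ≤ 1
count-≟≤1 i = count-unique (_≟ i) λ j≡i k≡i → trans j≡i (sym k≡i)

count-Satisfiable : (P? : Decidable P) → 0 < count P? → Satisfiable P
count-Satisfiable {suc n} P? pos with P? zero
... | yes p = zero , p
... | no  _ with count-Satisfiable (P? ∘ suc) pos
...   | i , p = suc i , p

module _ {n} {P : Pred (Fin n) 0ℓ} (P? : Decidable P) (f : Fin n → ℕ) where

  private
    satisfiers : List (Fin n)
    satisfiers = filter P? (allFin n)

    satisfier : P ⊆ (_∈ satisfiers)
    satisfier {i} p = ∈-filter⁺ P? (∈-allFin i) p

  argmin-Satisfiable : Satisfiable P → Σ[ i ∈ Fin n ] P i × (∀ {j} → P j → f i ≤ f j)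
  argmin-Satisfiable (i , p) =
    argmin f i satisfiers , argmin-all f p (all-filter P? (allFin n)) ,
    lookup (f[argmin]≤f[xs] i satisfiers) ∘ satisfier

  argmax-Satisfiable : Satisfiable P → Σ[ i ∈ Fin n ] P i × (∀ {j} → P j → f j ≤ f i)
  argmax-Satisfiable (i , p) =
    argmax f i satisfiers , argmax-all f p (all-filter P? (allFin n)) ,
    lookup (f[xs]≤f[argmax] i satisfiers) ∘ satisfier

Range : ℕ → ℕ → Pred ℕ 0ℓ
Range a l k = a ≤ k × k < a + l

≡⇒⊆ : {P Q : Pred ℕ 0ℓ} → P ≡ Q → P ⊆ Q
≡⇒⊆ refl = id

Range-shift : ∀ {a a' l} → a ≡ a' → Range a l ⊆ Range a' l
Range-shift a≡a' = ≡⇒⊆ (cong (λ a → Range a _) a≡a')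

block-⊆ : ∀ a {u ts} (m : u ∈ ts) → Range (a + before m) (leafCount u) ⊆ Range a (leafCountF ts)
block-⊆ a {u} {ts} m (a+b≤k , k<) = ≤-trans (m≤m+n a (before m)) a+b≤k , <-≤-trans k< bound
  where
  before-bound : ∀ {u ts} (m : u ∈ ts) → before m + leafCount u ≤ leafCountF ts
  before-bound (here refl) = m≤m+n _ _
  before-bound {u} (there {x = x} m) =
    ≤-trans (≤-reflexive (+-assoc (leafCount x) (before m) (leafCount u)))
            (+-monoʳ-≤ (leafCount x) (before-bound m))
  bound : a + before m + leafCount u ≤ a + leafCountF ts
  bound = ≤-trans (≤-reflexive (+-assoc a (before m) (leafCount u))) (+-monoʳ-≤ a (before-bound m))

block-cover : ∀ a ts {k} → Range a (leafCountF ts) k →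
              Σ[ u ∈ Tree ] Σ[ m ∈ u ∈ ts ] Range (a + before m) (leafCount u) k
block-cover a [] (a≤k , k<a+0) = contradiction (≤-<-trans a≤k k<a+0) (<-irrefl (sym (+-identityʳ a)))
block-cover a (t ∷ ts) {k} (a≤k , k<) with k <? a + leafCount t
... | yes k<a+t = t , here refl , Range-shift (sym (+-identityʳ a)) (a≤k , k<a+t)
... | no  k≮a+t with block-cover (a + leafCount t) ts (≮⇒≥ k≮a+t , subst (k <_) (sym (+-assoc a _ _)) k<)
...   | u , m , k∈m = u , there m , Range-shift (+-assoc a (leafCount t) (before m)) k∈m

block-end-unique : ∀ a {ts u u'} (m : u ∈ ts) (m' : u' ∈ ts) {k} →
  Range (a + before m) (leafCount u) k → Range (a + before m') (leafCount u') k →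
  a + before m + leafCount u ≡ a + before m' + leafCount u'
block-end-unique a (here refl) (here refl) _ _ = refl
block-end-unique a (here refl) (there {x = x} m') (_ , k<) (a+x+b≤k , _) =
  contradiction (<-≤-trans k< (≤-trans a+0+x≤a+x+b a+x+b≤k)) (n≮n _)
  where
  a+0+x≤a+x+b : a + 0 + leafCount x ≤ a + (leafCount x + before m')
  a+0+x≤a+x+b = ≤-trans (≤-reflexive (cong (_+ leafCount x) (+-identityʳ a))) (+-monoʳ-≤ a (m≤m+n _ _))
block-end-unique a (there m) m'@(here refl) k∈m k∈m' = sym (block-end-unique a m' (there m) k∈m' k∈m)
block-end-unique a (there {x = x} m) (there m') k∈m k∈m'
  rewrite sym (+-assoc a (leafCount x) (before m)) | sym (+-assoc a (leafCount x) (before m')) =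
  block-end-unique (a + leafCount x) m m' k∈m k∈m'

children : Tree → List Tree
children (node ts) = ts

end : ∀ {t} → Pos t → ℕ
end x = offset x + leafCount (subtree x)

childAt : ∀ {t} (w : Pos t) {u} → u ∈ children (subtree w) → Pos t
childAt {node ts} root m = down m root
childAt (down m' p) m = down m' (childAt p m)

childAt-Child : ∀ {t} (w : Pos t) {u} (m : u ∈ children (subtree w)) → Child (childAt w m) w
childAt-Child {node ts} root m = top m
childAt-Child (down m' p) m = deeper (childAt-Child p m)

Child⇒childAt : ∀ {t} {y w : Pos t} → Child y w →
                Σ[ u ∈ Tree ] Σ[ m ∈ u ∈ children (subtree w) ] y ≡ childAt w m
Child⇒childAt (top m) = _ , m , refl
Child⇒childAt (deeper c) with Child⇒childAt c
... | u , m , refl = u , m , refl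

offset-childAt : ∀ {t} (w : Pos t) {u} (m : u ∈ children (subtree w)) →
                 offset (childAt w m) ≡ offset w + before m
offset-childAt {node ts} root m = +-identityʳ (before m)
offset-childAt (down m' p) m =
  trans (cong (before m' +_) (offset-childAt p m)) (sym (+-assoc (before m') (offset p) (before m)))

subtree-childAt : ∀ {t} (w : Pos t) {u} (m : u ∈ children (subtree w)) → subtree (childAt w m) ≡ u
subtree-childAt {node ts} root m = refl
subtree-childAt (down m' p) m = subtree-childAt p m

InL-childAt : ∀ {t} (w : Pos t) {u} (m : u ∈ children (subtree w)) →
              InL (childAt w m) ≡ Range (offset w + before m) (leafCount u)
InL-childAt w m = cong₂ Range (offset-childAt w m) (cong leafCount (subtree-childAt w m))

end-childAt : ∀ {t} (w : Pos t) {u} (m : u ∈ children (subtree w)) →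
              end (childAt w m) ≡ offset w + before m + leafCount u
end-childAt w m = cong₂ _+_ (offset-childAt w m) (cong leafCount (subtree-childAt w m))

leafCount-branch : ∀ s → children s ≢ [] → leafCount s ≡ leafCountF (children s)
leafCount-branch (node [])      leaf = contradiction refl leaf
leafCount-branch (node (_ ∷ _)) _    = refl

leafCount-pos : ∀ s → 0 < leafCount s
leafCount-pos (node [])      = s≤s z≤n
leafCount-pos (node (t ∷ _)) = <-≤-trans (leafCount-pos t) (m≤m+n _ _)

leafCount-leaf : ∀ s → children s ≡ [] → leafCount s ≡ 1
leafCount-leaf (node []) _ = refl

childAt-⊆ : ∀ {t} (w : Pos t) {u} (m : u ∈ children (subtree w)) → InL (childAt w m) ⊆ InL w
childAt-⊆ w {u} m =
  ≡⇒⊆ (cong (Range (offset w)) (sym (leafCount-branch (subtree w) nonleaf)))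
  ∘ block-⊆ (offset w) m
  ∘ ≡⇒⊆ (InL-childAt w m)
  where
  nonleaf : children (subtree w) ≢ []
  nonleaf leaf with subst (u ∈_) leaf m
  ... | ()

childAt-cover : ∀ {t} (w : Pos t) → children (subtree w) ≢ [] →
                ∀ {k} → InL w k → Σ[ u ∈ Tree ] Σ[ m ∈ u ∈ children (subtree w) ] InL (childAt w m) k
childAt-cover w nonleaf k∈w
  with block-cover (offset w) (children (subtree w))
                   (≡⇒⊆ (cong (Range (offset w)) (leafCount-branch (subtree w) nonleaf)) k∈w)
... | u , m , k∈m = u , m , ≡⇒⊆ (sym (InL-childAt w m)) k∈m

Child-end-unique : ∀ {t} {y y' w : Pos t} → Child y w → Child y' w →
                   ∀ {k} → InL y k → InL y' k → end y ≡ end y'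
Child-end-unique {w = w} c c' k∈y k∈y' with Child⇒childAt c | Child⇒childAt c'
... | u , m , refl | u' , m' , refl = begin
  end (childAt w m)                    ≡⟨ end-childAt w m ⟩
  offset w + before m + leafCount u    ≡⟨ block-end-unique (offset w) m m' (≡⇒⊆ (InL-childAt w m) k∈y)
                                                                            (≡⇒⊆ (InL-childAt w m') k∈y') ⟩
  offset w + before m' + leafCount u' ≡⟨ end-childAt w m' ⟨
  end (childAt w m')                   ∎
  where open ≡-Reasoning

Child-leaves-before-end : ∀ {t} {y y' w : Pos t} → Child y w → Child y' w →
  ∀ {h a a'} → InL y h → InL y' a → a ≤ h → InL y' a' → a' < end y
Child-leaves-before-end {y = y} {y'} c c' {h} {a} {a'} h∈y (y'≤a , _) a≤h (_ , a'<y') with a' <? end y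
... | yes a'<y = a'<y
... | no  a'≮y = subst (a' <_) (Child-end-unique c' c h∈y' h∈y) a'<y'
  where
  h∈y' : InL y' h
  h∈y' = ≤-trans y'≤a a≤h , <-≤-trans (proj₂ h∈y) (≤-trans (≮⇒≥ a'≮y) (<⇒≤ a'<y'))

search∈ : ∀ (ts : List Tree) (P : ∀ {u} → u ∈ ts → Set) → (∀ {u} (m : u ∈ ts) → Dec (P m)) →
          (Σ[ u ∈ Tree ] Σ[ m ∈ u ∈ ts ] P m) ⊎ (∀ {u} (m : u ∈ ts) → ¬ P m)
search∈ []       P P? = inj₂ λ ()
search∈ (t ∷ ts) P P? with P? (here refl) | search∈ ts (P ∘ there) (P? ∘ there)
... | yes p | _                = inj₁ (t , here refl , p)
... | no  _ | inj₁ (u , m , p) = inj₁ (u , there m , p)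
... | no ¬p | inj₂ ¬ps         = inj₂ λ { (here refl) → ¬p ; (there m) → ¬ps m }

mutual
  size : Tree → ℕ
  size (node ts) = suc (sizeF ts)

  sizeF : List Tree → ℕ
  sizeF []       = 0
  sizeF (t ∷ ts) = size t + sizeF ts

size-childAt : ∀ {t} (w : Pos t) {u} (m : u ∈ children (subtree w)) →
               size (subtree (childAt w m)) < size (subtree w)
size-childAt w m rewrite subtree-childAt w m = size-child (subtree w) m
  where
  sizeF-∈ : ∀ {u ts} → u ∈ ts → size u ≤ sizeF ts
  sizeF-∈ (here refl) = m≤m+n _ _
  sizeF-∈ {ts = t ∷ _} (there m) = ≤-trans (sizeF-∈ m) (m≤n+m _ (size t))
  size-child : ∀ s {u} → u ∈ children s → size u < size s
  size-child (node _) m = s≤s (sizeF-∈ m)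

module _ {t : Tree} (P : Pred (Pos t) 0ℓ) (P? : Decidable P) where

  DeepestBelow : Pos t → Set
  DeepestBelow w =
    Σ[ w' ∈ Pos t ] InL w' ⊆ InL w × P w' × (∀ {u} (m : u ∈ children (subtree w')) → ¬ P (childAt w' m))

  deepest : (w : Pos t) → P w → DeepestBelow w
  deepest w = go (size (subtree w)) w ≤-refl
    where
    go : (fuel : ℕ) (w : Pos t) → size (subtree w) ≤ fuel → P w → DeepestBelow w
    go fuel w w≤fuel pw with search∈ (children (subtree w)) (P ∘ childAt w) (P? ∘ childAt w)
    ... | inj₂ none = w , id , pw , none
    go zero w w≤0 _ | inj₁ (_ , m , _) = contradiction (≤-trans (size-childAt w m) w≤0) λ ()
    go (suc fuel) w w≤fuel _ | inj₁ (_ , m , pm)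
      with go fuel (childAt w m) (≤-pred (≤-trans (size-childAt w m) w≤fuel)) pm
    ... | w' , w'⊆m , pw' , none = w' , childAt-⊆ w m ∘ w'⊆m , pw' , none

module _ {T : Tree} where

  bounds⇒SubL : (I : Interval T) (x : Pos T) → offset x ≤ lo I → hi I < end x → SubL I x
  bounds⇒SubL I x x≤I I<x k (lo≤k , k≤hi) = ≤-trans x≤I lo≤k , ≤-<-trans k≤hi I<x

  SubL? : (I : Interval T) (x : Pos T) → Dec (SubL I x)
  SubL? I x = map′ (uncurry (bounds⇒SubL I x))
                   (λ I⊆x → proj₁ (I⊆x (lo I) (≤-refl , lo≤hi I)) ,
                            proj₂ (I⊆x (hi I) (lo≤hi I , ≤-refl)))
                   (offset x ≤? lo I ×-dec hi I <? end x)

  InI? : (I : Interval T) → Decidable (InI I)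
  InI? I k = lo I ≤? k ×-dec k ≤? hi I

  Meets? : (y : Pos T) (I : Interval T) → Dec (Meets y I)
  Meets? y I = map′ witness (λ (_ , (y≤k , k<y) , (I≤k , k≤I)) → ≤-<-trans I≤k k<y , ≤-trans y≤k k≤I)
                            (lo I <? end y ×-dec offset y ≤? hi I)
    where
    witness : lo I < end y × offset y ≤ hi I → Meets y I
    witness (I<y , y≤I) with lo I ≤? offset y
    ... | yes I≤y = offset y , (≤-refl , m<m+n (offset y) (leafCount-pos (subtree y))) , I≤y , y≤I
    ... | no  I≰y = lo I , (<⇒≤ (≰⇒> I≰y) , I<y) , ≤-refl , lo≤hi I

  SubL⇒Meets : (I : Interval T) (x : Pos T) → SubL I x → Meets x I
  SubL⇒Meets I x I⊆x = lo I , I⊆x (lo I) (≤-refl , lo≤hi I) , ≤-refl , lo≤hi I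

  Meets-⊆ : {y z : Pos T} {I : Interval T} → InL y ⊆ InL z → Meets y I → Meets z I
  Meets-⊆ y⊆z (k , k∈y , k∈I) = k , y⊆z k∈y , k∈I

-- With b = suc k, the at least (b+2)·M − 2 members inside L(w) exceed the k·(M+1)
-- members the greedy selection of b members may discard.
greedy-threshold : ∀ k M c → suc k + 2 ≤ M → (suc k + 2) * M ≤ 2 + c → k * suc M < c
greedy-threshold k M c B≤M BM≤2+c = +-cancelˡ-≤ 2 _ _ (begin
  2 + suc (k * suc M)   ≡⟨ rearrange k M ⟩
  (suc k + 2) + k * M   ≤⟨ +-mono-≤ B≤M (*-monoˡ-≤ M (m≤m+n k 2)) ⟩
  M + (k + 2) * M       ≤⟨ BM≤2+c ⟩
  2 + c                 ∎)
  where
  open ≤-Reasoning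
  rearrange : ∀ k M → 2 + suc (k * suc M) ≡ (suc k + 2) + k * M
  rearrange = solve-∀

module _ {T : Tree} {n : ℕ} (𝓘 : IntervalFamily T n) where

  private
    F : Fin n → Interval T
    F = fam 𝓘

  Within : Pos T → Pred (Fin n) 0ℓ
  Within x i = SubL (F i) x

  Within? : (x : Pos T) → Decidable (Within x)
  Within? x i = SubL? (F i) x

  #within : Pos T → ℕ
  #within x = count (Within? x)

  #containing≤1 : ∀ k → count (λ i → InI? (F i) k) ≤ 1
  #containing≤1 k = count-unique (λ i → InI? (F i) k)
    λ {i} {j} k∈i k∈j → decidable-stable (i ≟ j) λ i≢j → disjoint 𝓘 i j i≢j k k∈i k∈j

  #within-leaf≤1 : (w : Pos T) → children (subtree w) ≡ [] → #within w ≤ 1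
  #within-leaf≤1 w leaf = ≤-trans (count-mono (Within? w) (λ i → InI? (F i) (offset w)) contains-offset)
                                  (#containing≤1 (offset w))
    where
    contains-offset : Within w ⊆ (λ i → InI (F i) (offset w))
    contains-offset {i} I⊆w with I⊆w (lo (F i)) (≤-refl , lo≤hi (F i))
    ... | w≤lo , lo<w+l = ≤-pred (subst (lo (F i) <_) w+l≡1+w lo<w+l) , ≤-trans w≤lo (lo≤hi (F i))
      where
      w+l≡1+w : offset w + leafCount (subtree w) ≡ suc (offset w)
      w+l≡1+w = trans (cong (offset w +_) (leafCount-leaf (subtree w) leaf)) (+-comm (offset w) 1)

  lo≤lo⇒hi<lo : ∀ i j → i ≢ j → lo (F i) ≤ lo (F j) → hi (F i) < lo (F j)
  lo≤lo⇒hi<lo i j i≢j lo≤lo with lo (F j) ≤? hi (F i)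
  ... | yes j≤i = ⊥-elim (disjoint 𝓘 i j i≢j (lo (F j)) (lo≤lo , j≤i) (≤-refl , lo≤hi (F j)))
  ... | no  j≰i = ≰⇒> j≰i

  hi≤hi⇒hi<lo : ∀ i j → i ≢ j → hi (F j) ≤ hi (F i) → hi (F j) < lo (F i)
  hi≤hi⇒hi<lo i j i≢j hi≤hi with lo (F i) ≤? hi (F j)
  ... | yes i≤j = ⊥-elim (disjoint 𝓘 i j i≢j (hi (F j)) (i≤j , hi≤hi) (lo≤hi (F j) , ≤-refl))
  ... | no  i≰j = ≰⇒> i≰j

  #within-root : #within root ≡ n
  #within-root = count-Universal (Within? root)
    λ i k (_ , k≤hi) → z≤n , ≤-<-trans k≤hi (hi<T (F i))

  #within-between-extremes : (x w : Pos T) {I₁ Iₘ : Fin n} →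
    (∀ {j} → Within x j → lo (F I₁) ≤ lo (F j)) →
    (∀ {j} → Within x j → hi (F j) ≤ hi (F Iₘ)) →
    Meets w (F I₁) → Meets w (F Iₘ) → #within x ≤ 2 + #within w
  #within-between-extremes x w {I₁} {Iₘ} I₁-min Iₘ-max
                           (a , (w≤a , _) , (_ , a≤I₁)) (a' , (_ , a'<w) , (Iₘ≤a' , _)) = begin
    #within x                                   ≤⟨ count-⊆∪ (Within? x) ((_≟ I₁) ∪? (_≟ Iₘ)) (Within? w) inside ⟩
    count ((_≟ I₁) ∪? (_≟ Iₘ)) + #within w      ≤⟨ +-monoˡ-≤ (#within w) (count-∪ (_≟ I₁) (_≟ Iₘ)) ⟩
    count (_≟ I₁) + count (_≟ Iₘ) + #within w   ≤⟨ +-monoˡ-≤ (#within w) (+-mono-≤ (count-≟≤1 I₁) (count-≟≤1 Iₘ)) ⟩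
    2 + #within w                               ∎
    where
    open ≤-Reasoning
    inside : Within x ⊆ ((_≡ I₁) ∪ (_≡ Iₘ)) ∪ Within w
    inside {j} j⊆x with j ≟ I₁ | j ≟ Iₘ
    ... | yes j≡I₁ | _        = inj₁ (inj₁ j≡I₁)
    ... | no  _    | yes j≡Iₘ = inj₁ (inj₂ j≡Iₘ)
    ... | no  j≢I₁ | no  j≢Iₘ = inj₂ (bounds⇒SubL (F j) w
        (≤-trans w≤a (≤-trans a≤I₁ (<⇒≤ (lo≤lo⇒hi<lo I₁ j (j≢I₁ ∘ sym) (I₁-min j⊆x)))))
        (<-trans (<-≤-trans (hi≤hi⇒hi<lo Iₘ j (j≢Iₘ ∘ sym) (Iₘ-max j⊆x)) Iₘ≤a') a'<w))

  module Greedy (w : Pos T) (M : ℕ)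
                (few : ∀ {u} (m : u ∈ children (subtree w)) → #within (childAt w m) < M) where

    From : ℕ → Pred (Fin n) 0ℓ
    From p i = Within w i × p ≤ lo (F i)

    From? : ∀ p → Decidable (From p)
    From? p i = Within? w i ×-dec p ≤? lo (F i)

    Separated : ∀ {b} → (Fin b → Fin n) → Set
    Separated sel = ∀ y → Child y w → ∀ i j → i ≢ j → Meets y (F (sel i)) → Meets y (F (sel j)) → ⊥

    Selection : ℕ → ℕ → Set
    Selection b p =
      Σ[ sel ∈ (Fin b → Fin n) ] (∀ i j → sel i ≡ sel j → i ≡ j) × (∀ i → From p (sel i)) × Separated sel

    prepend : ∀ {b p I} → From p I → ∀ {u} (m : u ∈ children (subtree w)) → InL (childAt w m) (hi (F I)) →
              Selection b (end (childAt w m)) → Selection (suc b) p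
    prepend {b} {p} {I} I∈p m hi∈y (sel , sel-inj , sel-from , sel-sep) =
      sel′ , sel′-inj , sel′-from , sel′-sep
      where
      lo<y : lo (F I) < end (childAt w m)
      lo<y = ≤-<-trans (lo≤hi (F I)) (proj₂ hi∈y)
      sel′ : Fin (suc b) → Fin n
      sel′ zero    = I
      sel′ (suc i) = sel i
      I≢sel : ∀ j → I ≢ sel j
      I≢sel j refl = <⇒≱ lo<y (proj₂ (sel-from j))
      sel′-inj : ∀ i j → sel′ i ≡ sel′ j → i ≡ j
      sel′-inj zero    zero    _ = refl
      sel′-inj zero    (suc j) e = contradiction e (I≢sel j)
      sel′-inj (suc i) zero    e = contradiction (sym e) (I≢sel i)
      sel′-inj (suc i) (suc j) e = cong suc (sel-inj i j e)
      sel′-from : ∀ i → From p (sel′ i)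
      sel′-from zero    = I∈p
      sel′-from (suc i) =
        proj₁ (sel-from i) , ≤-trans (proj₂ I∈p) (≤-trans (<⇒≤ lo<y) (proj₂ (sel-from i)))
      unshared : ∀ {y} → Child y w → Meets y (F I) → ∀ j → ¬ Meets y (F (sel j))
      unshared c (a , a∈y , (_ , a≤hi)) j (a' , a'∈y , (lo≤a' , _)) =
        <⇒≱ (Child-leaves-before-end (childAt-Child w m) c hi∈y a∈y a≤hi a'∈y)
            (≤-trans (proj₂ (sel-from j)) lo≤a')
      sel′-sep : Separated sel′
      sel′-sep y c zero    zero    i≢j _  _  = i≢j refl
      sel′-sep y c zero    (suc j) _   mi mj = unshared c mi j mj
      sel′-sep y c (suc i) zero    _   mi mj = unshared c mj i mi
      sel′-sep y c (suc i) (suc j) i≢j mi mj = sel-sep y c i j (i≢j ∘ cong suc) mi mj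

    #From-step : ∀ {p I} → From p I → (∀ {j} → From p j → lo (F I) ≤ lo (F j)) →
                 ∀ {u} (m : u ∈ children (subtree w)) → InL (childAt w m) (hi (F I)) →
                 count (From? p) ≤ count (From? (end (childAt w m))) + suc M
    #From-step {p} {I} I∈p I-min m hi∈y = begin
      count (From? p)                  ≤⟨ count-⊆∪ (From? p) (From? p′) Lost? split ⟩
      count (From? p′) + count Lost?   ≤⟨ +-monoʳ-≤ (count (From? p′)) lost-bound ⟩
      count (From? p′) + suc M         ∎
      where
      open ≤-Reasoning
      y  = childAt w m
      p′ = end y
      Containing? : Decidable (λ j → InI (F j) p′)
      Containing? j = InI? (F j) p′
      Lost? : Decidable (((_≡ I) ∪ (λ j → InI (F j) p′)) ∪ Within y)
      Lost? = ((_≟ I) ∪? Containing?) ∪? Within? y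
      lost-bound : count Lost? ≤ suc M
      lost-bound = begin
        count Lost?                                    ≤⟨ count-∪ ((_≟ I) ∪? Containing?) (Within? y) ⟩
        count ((_≟ I) ∪? Containing?) + #within y      ≤⟨ +-monoˡ-≤ (#within y) (count-∪ (_≟ I) Containing?) ⟩
        count (_≟ I) + count Containing? + #within y   ≤⟨ +-monoˡ-≤ (#within y)
                                                             (+-mono-≤ (count-≟≤1 I) (#containing≤1 p′)) ⟩
        suc (suc (#within y))                          ≤⟨ s≤s (few m) ⟩
        suc M                                          ∎
      split : From p ⊆ From p′ ∪ (((_≡ I) ∪ (λ j → InI (F j) p′)) ∪ Within y)
      split {j} j∈p with p′ ≤? lo (F j) | j ≟ I | hi (F j) <? p′
      ... | yes p′≤lo | _       | _       = inj₁ (proj₁ j∈p , p′≤lo)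
      ... | no  _     | yes j≡I | _       = inj₂ (inj₁ (inj₁ j≡I))
      ... | no  _     | no  j≢I | yes hi<p′ = inj₂ (inj₂ (bounds⇒SubL (F j) y
          (≤-trans (proj₁ hi∈y) (<⇒≤ (lo≤lo⇒hi<lo I j (j≢I ∘ sym) (I-min j∈p)))) hi<p′))
      ... | no  p′≰lo | no  _   | no  hi≮p′ = inj₂ (inj₁ (inj₂ (<⇒≤ (≰⇒> p′≰lo) , ≮⇒≥ hi≮p′)))

    nonleaf : ∀ {p} → 1 < count (From? p) → children (subtree w) ≢ []
    nonleaf {p} many leaf =
      <⇒≱ many (≤-trans (count-mono (From? p) (Within? w) proj₁) (#within-leaf≤1 w leaf))

    select : ∀ k p → k * suc M < count (From? p) → Selection (suc k) p
    select zero p any with count-Satisfiable (From? p) any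
    ... | i , i∈p =
      (λ _ → i) , (λ { zero zero _ → refl }) , (λ _ → i∈p) , λ { _ _ zero zero i≢j _ _ → i≢j refl }
    select (suc k) p many
      with argmin-Satisfiable (From? p) (lo ∘ F) (count-Satisfiable (From? p) (<-≤-trans z<s many))
    ... | I , I∈p , I-min
      with childAt-cover w (nonleaf (≤-<-trans (s≤s z≤n) many))
                         (proj₁ I∈p (hi (F I)) (lo≤hi (F I) , ≤-refl))
    ... | _ , m , hi∈y = prepend I∈p m hi∈y (select k (end (childAt w m)) rest)
      where
      rest : k * suc M < count (From? (end (childAt w m)))
      rest = +-cancelˡ-< (suc M) _ _ (<-≤-trans many
               (≤-trans (#From-step I∈p I-min m hi∈y) (≤-reflexive (+-comm _ (suc M)))))

    branching : ∀ k → k * suc M < #within w → Branching 𝓘 (suc k) w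
    branching k many with select k 0 (<-≤-trans many (count-mono (Within? w) (From? 0) (_, z≤n)))
    ... | sel , sel-inj , sel-from , sel-sep = sel , sel-inj , proj₁ ∘ sel-from , sel-sep

  AvoidingDescendant : ℕ → Pos T → Set
  AvoidingDescendant M x =
    Σ[ i ∈ Fin n ] Σ[ z ∈ Pos T ] Within x i × InL z ⊆ InL x × ¬ Meets z (F i) × M ≤ #within z

  branching-or-avoiding : ∀ k M x → suc k + 2 ≤ M → (suc k + 2) * M ≤ #within x →
                          (∃[ w ] Branching 𝓘 (suc k) w) ⊎ AvoidingDescendant M x
  branching-or-avoiding k M x B≤M many
    with argmin-Satisfiable (Within? x) (lo ∘ F) nonempty | argmax-Satisfiable (Within? x) (hi ∘ F) nonempty
    where
    nonempty : Satisfiable (Within x)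
    nonempty = count-Satisfiable (Within? x)
                 (<-≤-trans (<-≤-trans z<s B≤M) (≤-trans (m≤n*m M (suc k + 2)) many))
  ... | I₁ , I₁⊆x , I₁-min | Iₘ , Iₘ⊆x , Iₘ-max
    with deepest (λ w → Meets w (F I₁) × Meets w (F Iₘ)) (λ w → Meets? w (F I₁) ×-dec Meets? w (F Iₘ))
                 x (SubL⇒Meets (F I₁) x I₁⊆x , SubL⇒Meets (F Iₘ) x Iₘ⊆x)
  ... | w , w⊆x , (w∩I₁ , w∩Iₘ) , no-child-meets-both
    with search∈ (children (subtree w)) (λ m → M ≤ #within (childAt w m))
                                        (λ m → M ≤? #within (childAt w m))
  ... | inj₂ all-few = inj₁ (w , Greedy.branching w M (≰⇒> ∘ all-few) k
          (greedy-threshold k M (#within w) B≤M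
            (≤-trans many (#within-between-extremes x w I₁-min Iₘ-max w∩I₁ w∩Iₘ))))
  ... | inj₁ (_ , m , big) with Meets? (childAt w m) (F I₁)
  ...   | no  y∩I₁=∅ = inj₂ (I₁ , childAt w m , I₁⊆x , w⊆x ∘ childAt-⊆ w m , y∩I₁=∅ , big)
  ...   | yes y∩I₁   = inj₂ (Iₘ , childAt w m , Iₘ⊆x , w⊆x ∘ childAt-⊆ w m ,
                               (λ y∩Iₘ → no-child-meets-both m (y∩I₁ , y∩Iₘ)) , big)

  PathBelow : ℕ → Pos T → Set
  PathBelow ℓ x = Σ[ P ∈ IntervalPath 𝓘 ℓ ] ∀ j → InL (proj₁ (proj₂ P) j) ⊆ InL x

  path-single : ∀ {i x} → Within x i → PathBelow 1 x
  path-single {i} {x} i⊆x = ((λ _ → i) , (λ _ → x) , (λ _ _ _ → i⊆x) , λ { zero zero () }) , λ _ → id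

  path-prepend : ∀ {ℓ i x z} → Within x i → InL z ⊆ InL x → ¬ Meets z (F i) →
                 PathBelow (suc ℓ) z → PathBelow (suc (suc ℓ)) x
  path-prepend {ℓ} {i} {x} {z} i⊆x z⊆x z∩i=∅ ((I , xs , nested , avoids) , below) =
    (I′ , xs′ , nested′ , avoids′) , below′
    where
    I′ : Fin (suc (suc ℓ)) → Fin n
    I′ zero    = i
    I′ (suc j) = I j
    xs′ : Fin (suc (suc ℓ)) → Pos T
    xs′ zero    = x
    xs′ (suc j) = xs j
    below′ : ∀ j → InL (xs′ j) ⊆ InL x
    below′ zero    = id
    below′ (suc j) = z⊆x ∘ below j
    nested′ : ∀ j k → toℕ j ≤ toℕ k → SubL (F (I′ k)) (xs′ j)
    nested′ zero    zero    _         = i⊆x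
    nested′ zero    (suc k) _         = λ l l∈I → z⊆x (below zero (nested zero k z≤n l l∈I))
    nested′ (suc j) (suc k) (s≤s j≤k) = nested j k j≤k
    avoids′ : ∀ j k → suc (toℕ j) ≡ toℕ k → ¬ Meets (xs′ k) (F (I′ j))
    avoids′ zero    (suc k) _ = z∩i=∅ ∘ Meets-⊆ {y = xs k} {z} {F i} (below k)
    avoids′ (suc j) (suc k) e = avoids j k (ℕ.suc-injective e)

  module _ (k : ℕ) where

    private
      B : ℕ
      B = suc k + 2

      B≤2*B^[1+t] : ∀ t → B ≤ 2 * B ^ suc t
      B≤2*B^[1+t] t = ≤-trans (m≤m*n B (B ^ t) {{m^n≢0 B t}}) (m≤m+n _ _)

      regroup : ∀ b y → b * (2 * y) ≡ 2 * (b * y)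
      regroup = solve-∀

    branching-or-path : ∀ t x → 2 * B ^ suc t ≤ #within x →
                        (∃[ w ] Branching 𝓘 (suc k) w) ⊎ PathBelow (suc t) x
    branching-or-path zero x many =
      inj₂ (path-single {x = x} (proj₂ (count-Satisfiable (Within? x)
        (<-≤-trans (<-≤-trans z<s (B≤2*B^[1+t] 0)) many))))
    branching-or-path (suc t) x many =
      Sum.[ inj₁ , descend ]′
        (branching-or-avoiding k M x (B≤2*B^[1+t] t) (≤-trans (≤-reflexive (regroup B (B ^ suc t))) many))
      where
      M : ℕ
      M = 2 * B ^ suc t
      descend : AvoidingDescendant M x → (∃[ w ] Branching 𝓘 (suc k) w) ⊎ PathBelow (suc (suc t)) x
      descend (i , z , i⊆x , z⊆x , z∩i=∅ , many′) =
        Sum.map₂ (path-prepend {t} {i} {x} {z} i⊆x z⊆x z∩i=∅) (branching-or-path t z many′)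
lemma12 : (b t : ℕ) (T : Tree) (𝓘 : IntervalFamily T (2 * (b + 2) ^ t)) →
    (∃[ x ] Branching 𝓘 b x) ⊎ IntervalPath 𝓘 t
lemma12 zero    t       T 𝓘 = inj₁ (root , (λ ()) , (λ ()) , (λ ()) , λ _ _ ())
lemma12 (suc k) zero    T 𝓘 = inj₂ ((λ ()) , (λ ()) , (λ ()) , λ ())
lemma12 (suc k) (suc t) T 𝓘 =
  Sum.map₂ proj₁ (branching-or-path 𝓘 k t root (≤-reflexive (sym (#within-root 𝓘))))
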